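{- Let $x,y$ be complex numbers with $x\neq 0$, $y\neq 0$, $x^2+4y\neq 0$. For every nonnegative integer $n$, $$2\sum_{k=0}^{\lfloor n/2\rfloor}\binom{n}{2k}L_{2k}(x,y)\,x^{n-2k}=L_n(x,y)+L_n(3x,\,y-2x^2).$$
   Context: For complex parameters $a,b$, the bivariate Lucas polynomials are defined by $L_0(a,b)=2$, $L_1(a,b)=a$ and $L_n(a,b)=aL_{n-1}(a,b)+bL_{n-2}(a,b)$ for $n\ge 2$. -}

module Defs where

open import Level using (Level)
open import Algebra.Bundles using (CommutativeRing)
open import Data.Nat using (ℕ; zero; suc; _∸_; _*_; ⌊_/2⌋)
open import Data.Nat.Combinatorics using (_C_)

module _ {c ℓ : Level} (R : CommutativeRing c ℓ) where
  open CommutativeRing R renaming (_*_ to _·_)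

  fromℕ : ℕ → Carrier
  fromℕ zero = 0#
  fromℕ (suc n) = 1# + fromℕ n

  pow : Carrier → ℕ → Carrier
  pow a zero = 1#
  pow a (suc n) = a · pow a n

  Lucas : ℕ → Carrier → Carrier → Carrier
  Lucas zero a b = 1# + 1#
  Lucas (suc zero) a b = a
  Lucas (suc (suc n)) a b = a · Lucas (suc n) a b + b · Lucas n a b

  sumTo : ℕ → (ℕ → Carrier) → Carrier
  sumTo zero f = f 0
  sumTo (suc m) f = sumTo m f + f (suc m)

  lhs6 : ℕ → Carrier → Carrier → Carrier
  lhs6 n x y = (1# + 1#) · sumTo ⌊ n /2⌋
    (λ k → fromℕ (n C (2 * k)) · Lucas (2 * k) x y · pow x (n ∸ 2 * k))

  rhs6 : ℕ → Carrier → Carrier → Carrier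
  rhs6 n x y = Lucas n x y + Lucas n (fromℕ 3 · x) (y - fromℕ 2 · pow x 2)

{-# OPTIONS --safe #-}
-- The binomial transform  Σ_j C(n,j) L_j(a,b) t^(n-j)  of a Lucas sequence is again a Lucas
-- sequence, namely L_n(a + 2t, b - ta - t²): by Pascal's rule both sides satisfy the same
-- second-order recurrence. Taking t = x and a = ±x gives L_n(3x, y - 2x²) and L_n(x, y). Adding
-- the two transforms, the odd-index terms cancel because L_j(-x,y) = (-1)^j L_j(x,y), and the
-- even-index terms double.
module Submission where

open import Defs
open import Level using (Level)
open import Algebra.Bundles using (CommutativeRing)
open import Data.Nat as ℕ using (ℕ; zero; suc; _∸_; ⌊_/2⌋; z≤n)
open import Data.Nat.Properties using (≤-refl; m≤n⇒m≤1+n; n<1+n; *-suc; +-∸-assoc)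
open import Data.Nat.Combinatorics using (_C_; nCk+nC[k+1]≡[n+1]C[k+1])
open import Data.Nat.Combinatorics.Specification using (k>n⇒nCk≡0)
open import Data.Product using (_×_; _,_; proj₁; proj₂)
open import Data.Sum as Sum using (_⊎_; inj₁; inj₂; [_,_]′)
open import Function using (_∘_)
open import Relation.Nullary using (¬_)
open import Relation.Binary.PropositionalEquality as ≡ using (_≡_)

⌊n/2⌋-parity : ∀ n → 2 ℕ.* ⌊ n /2⌋ ≡ n ⊎ suc (2 ℕ.* ⌊ n /2⌋) ≡ n
⌊n/2⌋-parity zero = inj₁ ≡.refl
⌊n/2⌋-parity (suc zero) = inj₂ ≡.refl
⌊n/2⌋-parity (suc (suc n)) =
  Sum.map (≡.trans (*-suc 2 ⌊ n /2⌋) ∘ ≡.cong (suc ∘ suc))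
          (≡.cong suc ∘ ≡.trans (*-suc 2 ⌊ n /2⌋) ∘ ≡.cong suc)
          (⌊n/2⌋-parity n)

module _ {c ℓ : Level} (R : CommutativeRing c ℓ) where
  open CommutativeRing R
  open import Algebra.Properties.Ring ring
    using (-‿distribˡ-*; -‿distribʳ-*; -‿involutive; -‿+-comm)
  open import Algebra.Properties.CommutativeSemigroup +-commutativeSemigroup using (interchange)
  open import Algebra.Solver.Ring.NaturalCoefficients.Default commutativeSemiring
    using (solve; _:=_; _:+_; _:*_; con)
  open import Relation.Binary.Reasoning.Setoid setoid

  fromℕ-+ : ∀ m n → fromℕ R (m ℕ.+ n) ≈ fromℕ R m + fromℕ R n
  fromℕ-+ zero n = sym (+-identityˡ _)
  fromℕ-+ (suc m) n = trans (+-congˡ (fromℕ-+ m n)) (sym (+-assoc _ _ _))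

  x-y+y≈x : ∀ x y → x - y + y ≈ x
  x-y+y≈x x y = trans (+-assoc _ _ _) (trans (+-congˡ (-‿inverseˡ y)) (+-identityʳ x))

  -x*-y≈x*y : ∀ x y → - x * - y ≈ x * y
  -x*-y≈x*y x y = begin
    - x * - y     ≈⟨ -‿distribˡ-* x (- y) ⟨
    - (x * - y)   ≈⟨ -‿cong (-‿distribʳ-* x y) ⟨
    - - (x * y)   ≈⟨ -‿involutive (x * y) ⟩
    x * y         ∎

  sumTo-cong : ∀ n {f g : ℕ → Carrier} → (∀ j → j ℕ.≤ n → f j ≈ g j) →
               sumTo R n f ≈ sumTo R n g
  sumTo-cong zero f≈g = f≈g 0 z≤n
  sumTo-cong (suc n) f≈g =
    +-cong (sumTo-cong n (λ j j≤n → f≈g j (m≤n⇒m≤1+n j≤n))) (f≈g (suc n) ≤-refl)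

  sumTo-distrib-+ : ∀ n f g → sumTo R n (λ j → f j + g j) ≈ sumTo R n f + sumTo R n g
  sumTo-distrib-+ zero f g = refl
  sumTo-distrib-+ (suc n) f g = trans (+-congʳ (sumTo-distrib-+ n f g)) (interchange _ _ _ _)

  *-distribˡ-sumTo : ∀ a n f → a * sumTo R n f ≈ sumTo R n (λ j → a * f j)
  *-distribˡ-sumTo a zero f = refl
  *-distribˡ-sumTo a (suc n) f = trans (distribˡ a _ _) (+-congʳ (*-distribˡ-sumTo a n f))

  sumTo-suc : ∀ n f → sumTo R (suc n) f ≈ f 0 + sumTo R n (f ∘ suc)
  sumTo-suc zero f = refl
  sumTo-suc (suc n) f = trans (+-congʳ (sumTo-suc n f)) (+-assoc _ _ _)

  sumTo-even : ∀ {f} → (∀ k → f (suc (2 ℕ.* k)) ≈ 0#) →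
               ∀ n → sumTo R n f ≈ sumTo R ⌊ n /2⌋ (λ k → f (2 ℕ.* k))
  sumTo-even {f} f-odd≈0 n =
    [ from (up-to-even ⌊ n /2⌋) , from (up-to-odd ⌊ n /2⌋) ]′ (⌊n/2⌋-parity n)
    where
    g : ℕ → Carrier
    g k = f (2 ℕ.* k)
    up-to-even : ∀ k → sumTo R (2 ℕ.* k) f ≈ sumTo R k g
    up-to-odd : ∀ k → sumTo R (suc (2 ℕ.* k)) f ≈ sumTo R k g
    up-to-even zero = refl
    up-to-even (suc k) = begin
      sumTo R (2 ℕ.* suc k) f
        ≡⟨ ≡.cong (λ m → sumTo R m f) (*-suc 2 k) ⟩
      sumTo R (suc (suc (2 ℕ.* k))) f
        ≈⟨ +-cong (up-to-odd k) (reflexive (≡.cong f (≡.sym (*-suc 2 k)))) ⟩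
      sumTo R (suc k) g ∎
    up-to-odd k = trans (+-cong (up-to-even k) (f-odd≈0 k)) (+-identityʳ _)
    from : ∀ {m} → sumTo R m f ≈ sumTo R ⌊ n /2⌋ g → m ≡ n → sumTo R n f ≈ sumTo R ⌊ n /2⌋ g
    from eq ≡.refl = eq

  binomialTransform : Carrier → (ℕ → Carrier) → ℕ → Carrier
  binomialTransform t f n = sumTo R n (λ j → fromℕ R (n C j) * f j * pow R t (n ∸ j))

  binomialTransform-zero : ∀ t f → binomialTransform t f 0 ≈ f 0
  binomialTransform-zero t f =
    trans (*-identityʳ _) (trans (*-congʳ (+-identityʳ 1#)) (*-identityˡ _))

  binomialTransform-+ : ∀ t f g n →
    binomialTransform t (λ j → f j + g j) n ≈ binomialTransform t f n + binomialTransform t g n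
  binomialTransform-+ t f g n =
    trans (sumTo-cong n (λ j _ → distrib-middle _ _ _ _)) (sumTo-distrib-+ n _ _)
    where
    distrib-middle : ∀ c u v p → c * (u + v) * p ≈ c * u * p + c * v * p
    distrib-middle = solve 4 (λ c u v p → c :* (u :+ v) :* p := c :* u :* p :+ c :* v :* p) refl

  binomialTransform-* : ∀ t a f n →
    binomialTransform t (λ j → a * f j) n ≈ a * binomialTransform t f n
  binomialTransform-* t a f n =
    trans (sumTo-cong n (λ j _ → pull-middle _ _ _ _)) (sym (*-distribˡ-sumTo a n _))
    where
    pull-middle : ∀ c a u p → c * (a * u) * p ≈ a * (c * u * p)
    pull-middle = solve 4 (λ c a u p → c :* (a :* u) :* p := a :* (c :* u :* p)) refl

  binomialTransform-suc : ∀ t f n →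
    binomialTransform t f (suc n) ≈ t * binomialTransform t f n + binomialTransform t (f ∘ suc) n
  binomialTransform-suc t f n = begin
    binomialTransform t f (suc n)
      ≈⟨ sumTo-suc n _ ⟩
    raised 0 + sumTo R n (λ j → fromℕ R (suc n C suc j) * f (suc j) * pow R t (n ∸ j))
      ≈⟨ +-congˡ (trans (sumTo-cong n (λ j _ → pascal j)) (sumTo-distrib-+ n _ _)) ⟩
    raised 0 + (binomialTransform t (f ∘ suc) n + sumTo R n (raised ∘ suc))
      ≈⟨ solve 3 (λ u v w → u :+ (v :+ w) := (u :+ w) :+ v) refl _ _ _ ⟩
    (raised 0 + sumTo R n (raised ∘ suc)) + binomialTransform t (f ∘ suc) n
      ≈⟨ +-congʳ (sym (sumTo-suc n raised)) ⟩
    sumTo R (suc n) raised + binomialTransform t (f ∘ suc) n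
      ≈⟨ +-congʳ (trans (+-congˡ top-vanishes) (+-identityʳ _)) ⟩
    sumTo R n raised + binomialTransform t (f ∘ suc) n
      ≈⟨ +-congʳ (sumTo-cong n raised≈t*) ⟨
    sumTo R n (λ j → t * (fromℕ R (n C j) * f j * pow R t (n ∸ j)))
      + binomialTransform t (f ∘ suc) n
      ≈⟨ +-congʳ (*-distribˡ-sumTo t n _) ⟨
    t * binomialTransform t f n + binomialTransform t (f ∘ suc) n ∎
    where
    raised : ℕ → Carrier
    raised j = fromℕ R (n C j) * f j * pow R t (suc n ∸ j)
    pascal : ∀ j → fromℕ R (suc n C suc j) * f (suc j) * pow R t (n ∸ j)
                 ≈ fromℕ R (n C j) * f (suc j) * pow R t (n ∸ j) + raised (suc j)
    pascal j = begin
      fromℕ R (suc n C suc j) * f (suc j) * pow R t (n ∸ j)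
        ≡⟨ ≡.cong (λ m → fromℕ R m * f (suc j) * pow R t (n ∸ j)) (nCk+nC[k+1]≡[n+1]C[k+1] n j) ⟨
      fromℕ R (n C j ℕ.+ n C suc j) * f (suc j) * pow R t (n ∸ j)
        ≈⟨ *-congʳ (*-congʳ (fromℕ-+ (n C j) (n C suc j))) ⟩
      (fromℕ R (n C j) + fromℕ R (n C suc j)) * f (suc j) * pow R t (n ∸ j)
        ≈⟨ solve 4 (λ c d u p → (c :+ d) :* u :* p := c :* u :* p :+ d :* u :* p) refl _ _ _ _ ⟩
      fromℕ R (n C j) * f (suc j) * pow R t (n ∸ j) + raised (suc j) ∎
    top-vanishes : raised (suc n) ≈ 0#
    top-vanishes = begin
      fromℕ R (n C suc n) * f (suc n) * pow R t (n ∸ n)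
        ≡⟨ ≡.cong (λ m → fromℕ R m * f (suc n) * pow R t (n ∸ n)) (k>n⇒nCk≡0 (n<1+n n)) ⟩
      0# * f (suc n) * pow R t (n ∸ n)
        ≈⟨ trans (*-congʳ (zeroˡ _)) (zeroˡ _) ⟩
      0# ∎
    raised≈t* : ∀ j → j ℕ.≤ n → t * (fromℕ R (n C j) * f j * pow R t (n ∸ j)) ≈ raised j
    raised≈t* j j≤n = begin
      t * (fromℕ R (n C j) * f j * pow R t (n ∸ j))
        ≈⟨ solve 4 (λ t c u p → t :* (c :* u :* p) := c :* u :* (t :* p)) refl _ _ _ _ ⟩
      fromℕ R (n C j) * f j * pow R t (suc (n ∸ j))
        ≡⟨ ≡.cong (λ m → fromℕ R (n C j) * f j * pow R t m) (+-∸-assoc 1 j≤n) ⟨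
      raised j ∎

  -- a′ = a + 2t and b′ = b - ta - t² are given by equations, which keeps the induction
  -- subtraction-free so that the semiring solver can do the algebra.
  binomialTransform-Lucas : ∀ a b t {a′ b′} → a′ ≈ a + (t + t) → b′ + t * a + t * t ≈ b →
    ∀ n → binomialTransform t (λ j → Lucas R j a b) n ≈ Lucas R n a′ b′
  binomialTransform-Lucas a b t {a′} {b′} a′≈ b≈ n = proj₁ (paired n)
    where
    T U : ℕ → Carrier
    T = binomialTransform t (λ j → Lucas R j a b)
    U = binomialTransform t (λ j → Lucas R (suc j) a b)
    L′ : ℕ → Carrier
    L′ j = Lucas R j a′ b′
    paired : ∀ n → T n ≈ L′ n × U n + t * L′ n ≈ L′ (suc n)
    paired zero =
      binomialTransform-zero t (λ j → Lucas R j a b) ,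
      trans (+-cong (binomialTransform-zero t (λ j → Lucas R (suc j) a b))
                    (solve 1 (λ t → t :* con 2 := t :+ t) refl t))
            (sym a′≈)
    paired (suc n) = T-suc , U-suc
      where
      T≈ : T n ≈ L′ n
      T≈ = proj₁ (paired n)
      U≈ : U n + t * L′ n ≈ L′ (suc n)
      U≈ = proj₂ (paired n)
      T-suc : T (suc n) ≈ L′ (suc n)
      T-suc = begin
        T (suc n)       ≈⟨ binomialTransform-suc t _ n ⟩
        t * T n + U n   ≈⟨ +-congʳ (*-congˡ T≈) ⟩
        t * L′ n + U n  ≈⟨ +-comm _ _ ⟩
        U n + t * L′ n  ≈⟨ U≈ ⟩
        L′ (suc n)      ∎
      U-suc : U (suc n) + t * L′ (suc n) ≈ L′ (suc (suc n))
      U-suc = begin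
        U (suc n) + t * L′ (suc n)
          ≈⟨ +-congʳ (binomialTransform-suc t _ n) ⟩
        (t * U n + binomialTransform t (λ j → a * Lucas R (suc j) a b + b * Lucas R j a b) n)
          + t * L′ (suc n)
          ≈⟨ +-congʳ (+-congˡ (trans (binomialTransform-+ t _ _ n)
                                     (+-cong (binomialTransform-* t a _ n)
                                             (binomialTransform-* t b _ n)))) ⟩
        (t * U n + (a * U n + b * T n)) + t * L′ (suc n)
          ≈⟨ +-cong (+-congˡ (+-congˡ (*-cong (sym b≈) T≈))) (*-congˡ (sym U≈)) ⟩
        (t * U n + (a * U n + (b′ + t * a + t * t) * L′ n)) + t * (U n + t * L′ n)
          ≈⟨ solve 5 (λ t a b′ u l →
                        (t :* u :+ (a :* u :+ (b′ :+ t :* a :+ t :* t) :* l)) :+ t :* (u :+ t :* l)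
                          := (a :+ (t :+ t)) :* (u :+ t :* l) :+ b′ :* l)
                     refl t a b′ (U n) (L′ n) ⟩
        (a + (t + t)) * (U n + t * L′ n) + b′ * L′ n
          ≈⟨ +-congʳ (*-cong (sym a′≈) U≈) ⟩
        L′ (suc (suc n)) ∎

  LucasSignPattern : Carrier → Carrier → ℕ → Set ℓ
  LucasSignPattern a b m =
    Lucas R m (- a) b ≈ Lucas R m a b × Lucas R (suc m) (- a) b ≈ - Lucas R (suc m) a b

  LucasSignPattern-suc-suc : ∀ {a b m} → LucasSignPattern a b m → LucasSignPattern a b (suc (suc m))
  LucasSignPattern-suc-suc {a} {b} {m} (even , odd) = even′ , odd′
    where
    even′ : - a * Lucas R (suc m) (- a) b + b * Lucas R m (- a) b
          ≈ a * Lucas R (suc m) a b + b * Lucas R m a b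
    even′ = +-cong (trans (*-congˡ odd) (-x*-y≈x*y a _)) (*-congˡ even)
    odd′ : - a * Lucas R (suc (suc m)) (- a) b + b * Lucas R (suc m) (- a) b
         ≈ - (a * Lucas R (suc (suc m)) a b + b * Lucas R (suc m) a b)
    odd′ = trans (+-cong (trans (*-congˡ even′) (sym (-‿distribˡ-* a _)))
                         (trans (*-congˡ odd) (sym (-‿distribʳ-* b _))))
                 (-‿+-comm _ _)

  LucasSignPattern-even : ∀ a b k → LucasSignPattern a b (2 ℕ.* k)
  LucasSignPattern-even a b zero = refl , refl
  LucasSignPattern-even a b (suc k) =
    ≡.subst (LucasSignPattern a b) (≡.sym (*-suc 2 k))
            (LucasSignPattern-suc-suc {m = 2 ℕ.* k} (LucasSignPattern-even a b k))

  binomialTransform-Lucas-even : ∀ t a b n →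
    binomialTransform t (λ j → Lucas R j a b + Lucas R j (- a) b) n
      ≈ (1# + 1#) * sumTo R ⌊ n /2⌋
                      (λ k → fromℕ R (n C (2 ℕ.* k)) * Lucas R (2 ℕ.* k) a b * pow R t (n ∸ 2 ℕ.* k))
  binomialTransform-Lucas-even t a b n = begin
    sumTo R n term                                      ≈⟨ sumTo-even odd≈0 n ⟩
    sumTo R ⌊ n /2⌋ (λ k → term (2 ℕ.* k))              ≈⟨ sumTo-cong ⌊ n /2⌋ (λ k _ → even≈ k) ⟩
    sumTo R ⌊ n /2⌋ (λ k → (1# + 1#) * evenTerm k)      ≈⟨ *-distribˡ-sumTo (1# + 1#) ⌊ n /2⌋ evenTerm ⟨
    (1# + 1#) * sumTo R ⌊ n /2⌋ evenTerm                ∎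
    where
    term evenTerm : ℕ → Carrier
    term j = fromℕ R (n C j) * (Lucas R j a b + Lucas R j (- a) b) * pow R t (n ∸ j)
    evenTerm k = fromℕ R (n C (2 ℕ.* k)) * Lucas R (2 ℕ.* k) a b * pow R t (n ∸ 2 ℕ.* k)
    odd≈0 : ∀ k → term (suc (2 ℕ.* k)) ≈ 0#
    odd≈0 k = trans (*-congʳ (*-congˡ (trans (+-congˡ (proj₂ (LucasSignPattern-even a b k)))
                                             (-‿inverseʳ _))))
                    (trans (*-congʳ (zeroʳ _)) (zeroˡ _))
    even≈ : ∀ k → term (2 ℕ.* k) ≈ (1# + 1#) * evenTerm k
    even≈ k = trans (*-congʳ (*-congˡ (+-congˡ (proj₁ (LucasSignPattern-even a b k)))))
                    (solve 3 (λ c l p → c :* (l :+ l) :* p := con 2 :* (c :* l :* p)) refl _ _ _)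

  lhs6≈rhs6 : ∀ x y n → lhs6 R n x y ≈ rhs6 R n x y
  lhs6≈rhs6 x y n = begin
    lhs6 R n x y
      ≈⟨ binomialTransform-Lucas-even x x y n ⟨
    binomialTransform x (λ j → Lucas R j x y + Lucas R j (- x) y) n
      ≈⟨ binomialTransform-+ x _ _ n ⟩
    binomialTransform x (λ j → Lucas R j x y) n + binomialTransform x (λ j → Lucas R j (- x) y) n
      ≈⟨ +-cong (binomialTransform-Lucas x y x 3x≈x+[x+x] [y-2x²]+x²+x²≈y n)
                (binomialTransform-Lucas (- x) y x x≈-x+[x+x] y-x²+x²≈y n) ⟩
    Lucas R n (fromℕ R 3 * x) (y - fromℕ R 2 * pow R x 2) + Lucas R n x y
      ≈⟨ +-comm _ _ ⟩
    rhs6 R n x y ∎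
    where
    3x≈x+[x+x] : fromℕ R 3 * x ≈ x + (x + x)
    3x≈x+[x+x] = solve 1 (λ x → (con 1 :+ (con 1 :+ (con 1 :+ con 0))) :* x := x :+ (x :+ x)) refl x
    2x² : Carrier
    2x² = fromℕ R 2 * pow R x 2
    [y-2x²]+x²+x²≈y : y - 2x² + x * x + x * x ≈ y
    [y-2x²]+x²+x²≈y = begin
      y - 2x² + x * x + x * x    ≈⟨ +-assoc _ _ _ ⟩
      y - 2x² + (x * x + x * x)  ≈⟨ +-congˡ (solve 1 (λ x → x :* x :+ x :* x
                                            := (con 1 :+ (con 1 :+ con 0)) :* (x :* (x :* con 1)))
                                          refl x) ⟩
      y - 2x² + 2x²              ≈⟨ x-y+y≈x y 2x² ⟩
      y                          ∎
    x≈-x+[x+x] : x ≈ - x + (x + x)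
    x≈-x+[x+x] = sym (trans (sym (+-assoc _ _ _)) (trans (+-congʳ (-‿inverseˡ x)) (+-identityˡ x)))
    y-x²+x²≈y : y + x * - x + x * x ≈ y
    y-x²+x²≈y = trans (+-congʳ (+-congˡ (sym (-‿distribʳ-* x x)))) (x-y+y≈x y (x * x))

mainTheorem6 : {c ℓ : Level} (R : CommutativeRing c ℓ) →
    let open CommutativeRing R in
    (x y : Carrier) → ¬ (x ≈ 0#) → ¬ (y ≈ 0#) →
    ¬ (x * x + (fromℕ R 4) * y ≈ 0#) →
    (n : ℕ) → lhs6 R n x y ≈ rhs6 R n x y
mainTheorem6 R x y _ _ _ = lhs6≈rhs6 R x y
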